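{- Let $X$ be a set of variables and $\Sigma$ an $\mathbf{L}$-set of inequalities over $T(X)$. Then the class $\mathrm{Mod}(\Sigma)$ of algebras with $\mathbf{L}$-order of type $F$ is closed under formations of subalgebras, homomorphic images, and direct products.
   Context: $\mathbf{L}=\langle L,\wedge,\vee,\otimes,\rightarrow,0,1\rangle$ is a complete residuated lattice; $F$ is a fixed type (function symbols with finite arities). An algebra with $\mathbf{L}$-order of type $F$ is $\mathbf{M}=\langle M,\preccurlyeq^{\mathbf{M}},F^{\mathbf{M}}\rangle$ where $\langle M,F^{\mathbf{M}}\rangle$ is an ordinary algebra of type $F$ ($M\ne\emptyset$) and $\preccurlyeq^{\mathbf{M}}:M\times M\to L$ satisfies $a\preccurlyeq^{\mathbf{M}}a=1$, $(a\preccurlyeq^{\mathbf{M}}b)\otimes(b\preccurlyeq^{\mathbf{M}}c)\le a\preccurlyeq^{\mathbf{M}}c$, $(a_1\preccurlyeq^{\mathbf{M}}b_1)\otimes\cdots\otimes(a_n\preccurlyeq^{\mathbf{M}}b_n)\le f^{\mathbf{M}}(a_1,\dots,a_n)\preccurlyeq^{\mathbf{M}}f^{\mathbf{M}}(b_1,\dots,b_n)$ for each $n$-ary $f\in F$, and ($a\preccurlyeq^{\mathbf{M}}b=b\preccurlyeq^{\mathbf{M}}a=1$ implies $a=b$). Subalgebra: for a nonempty $N\subseteq M$ closed under all $f^{\mathbf{M}}$, the algebra on $N$ with restricted operations and restricted $\preccurlyeq^{\mathbf{M}}$. Direct product of a family $\mathbf{M}_i$ ($i\in I$): universe $\prod_{i\in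 I}M_i$, operations componentwise, $a\preccurlyeq b=\bigwedge_{i\in I}a(i)\preccurlyeq^{\mathbf{M}_i}b(i)$ (the empty product is the one-element algebra with $\preccurlyeq$ the identity). A homomorphism $h:\mathbf{M}\to\mathbf{N}$ is a map $h:M\to N$ with $h(f^{\mathbf{M}}(a_1,\dots,a_n))=f^{\mathbf{N}}(h(a_1),\dots,h(a_n))$ and $a\preccurlyeq^{\mathbf{M}}b\le h(a)\preccurlyeq^{\mathbf{N}}h(b)$; $\mathbf{N}$ is a homomorphic image of $\mathbf{M}$ if there is a surjective homomorphism $\mathbf{M}\to\mathbf{N}$. $T(X)$ is the set of terms of type $F$ over variables $X$. An inequality is an expression $t\preccurlyeq t'$ with $t,t'\in T(X)$; an $\mathbf{L}$-set of inequalities is a map $\Sigma$ assigning to each inequality a degree in $L$. For an $\mathbf{M}$-valuation $v:X\to M$ with unique homomorphic extension $\bar v$ to terms, $\|t\preccurlyeq t'\|_{\mathbf{M},v}=\bar v(t)\preccurlyeq^{\mathbf{M}}\bar v(t')$ and $\|t\preccurlyeq t'\|_{\mathbf{M}}=\bigwedge_{v:X\to M}\|t\preccurlyeq t'\|_{\mathbf{M},v}$. $\mathrm{Mod}(\Sigma)$ is the class of all algebras with $\mathbf{L}$-order $\mathbf{M}$ of type $F$ such that $\Sigma(t\preccurlyeq t')\le\|t\preccurlyeq t'\|_{\mathbf{M}}$ for all $t,t'\in T(X)$. -}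

module Defs where

open import Level using (Level; 0ℓ) renaming (suc to lsuc)
open import Data.Nat using (ℕ; zero; suc)
open import Data.Fin using (Fin; zero; suc)
open import Data.Product using (Σ; _,_; proj₁; proj₂; _×_; ∃)
open import Function using (_∘_)
open import Relation.Binary.PropositionalEquality using (_≡_; refl; sym; trans; cong; cong₂)
open import Relation.Binary.Structures using (IsPartialOrder; IsEquivalence)

record CompleteResiduatedLattice : Set₁ where
  infixr 7 _⊗_
  infixr 5 _⇒_
  infixr 6 _∧_
  infixr 5 _∨_
  infix 4 _≤_
  field
    Carrier : Set
    _≤_ : Carrier → Carrier → Set
    ≤-isPartialOrder : IsPartialOrder _≡_ _≤_
    _∧_ _∨_ _⊗_ _⇒_ : Carrier → Carrier → Carrier
    0# 1# : Carrier
    ∧-lb₁ : ∀ a b → a ∧ b ≤ a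
    ∧-lb₂ : ∀ a b → a ∧ b ≤ b
    ∧-glb : ∀ {a b c} → c ≤ a → c ≤ b → c ≤ a ∧ b
    ∨-ub₁ : ∀ a b → a ≤ a ∨ b
    ∨-ub₂ : ∀ a b → b ≤ a ∨ b
    ∨-lub : ∀ {a b c} → a ≤ c → b ≤ c → a ∨ b ≤ c
    0-bot : ∀ a → 0# ≤ a
    1-top : ∀ a → a ≤ 1#
    ⊗-assoc : ∀ a b c → (a ⊗ b) ⊗ c ≡ a ⊗ (b ⊗ c)
    ⊗-comm : ∀ a b → a ⊗ b ≡ b ⊗ a
    ⊗-identityʳ : ∀ a → a ⊗ 1# ≡ a
    adj₁ : ∀ {a b c} → a ⊗ b ≤ c → a ≤ b ⇒ c
    adj₂ : ∀ {a b c} → a ≤ b ⇒ c → a ⊗ b ≤ c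
    ⋀ : {I : Set} → (I → Carrier) → Carrier
    ⋀-lb : ∀ {I} (g : I → Carrier) (i : I) → ⋀ g ≤ g i
    ⋀-glb : ∀ {I} (g : I → Carrier) {c} → (∀ i → c ≤ g i) → c ≤ ⋀ g
    ⋁ : {I : Set} → (I → Carrier) → Carrier
    ⋁-ub : ∀ {I} (g : I → Carrier) (i : I) → g i ≤ ⋁ g
    ⋁-lub : ∀ {I} (g : I → Carrier) {c} → (∀ i → g i ≤ c) → ⋁ g ≤ c

  open IsPartialOrder ≤-isPartialOrder public
    using () renaming (refl to ≤-refl; trans to ≤-trans; antisym to ≤-antisym)

  ⨂ : (n : ℕ) → (Fin n → Carrier) → Carrier
  ⨂ zero g = 1#
  ⨂ (suc n) g = g zero ⊗ ⨂ n (g ∘ suc)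

  ⊗-monoˡ : ∀ {a a'} b → a ≤ a' → a ⊗ b ≤ a' ⊗ b
  ⊗-monoˡ b p = adj₂ (≤-trans p (adj₁ ≤-refl))

  ⊗-mono : ∀ {a a' b b'} → a ≤ a' → b ≤ b' → a ⊗ b ≤ a' ⊗ b'
  ⊗-mono {a} {a'} {b} {b'} p q =
    ≤-trans (⊗-monoˡ b p)
      (subst≤ (⊗-comm b a') (⊗-comm b' a') (⊗-monoˡ a' q))
    where
    subst≤ : ∀ {x x' y y'} → x ≡ x' → y ≡ y' → x ≤ y → x' ≤ y'
    subst≤ refl refl r = r

  ⨂-mono : ∀ n {g h : Fin n → Carrier} → (∀ k → g k ≤ h k) → ⨂ n g ≤ ⨂ n h
  ⨂-mono zero p = ≤-refl
  ⨂-mono (suc n) p = ⊗-mono (p zero) (⨂-mono n (p ∘ suc))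

  ⋀-cong : ∀ {I} {g h : I → Carrier} → (∀ i → g i ≡ h i) → ⋀ g ≡ ⋀ h
  ⋀-cong {g = g} {h} e = ≤-antisym
    (⋀-glb h (λ i → ≤-trans (⋀-lb g i) (≤-reflexive (e i))))
    (⋀-glb g (λ i → ≤-trans (⋀-lb h i) (≤-reflexive (sym (e i)))))
    where
    ≤-reflexive : ∀ {x y} → x ≡ y → x ≤ y
    ≤-reflexive refl = ≤-refl

record Type : Set₁ where
  field
    Sym : Set
    arity : Sym → ℕ

module _ (F : Type) where
  open Type F

  data Term (X : Set) : Set where
    var : X → Term X
    app : (f : Sym) → (Fin (arity f) → Term X) → Term X

Inequality : (F : Type) → Set → Set
Inequality F X = Term F X × Term F X

LSet : (L : CompleteResiduatedLattice) (F : Type) → Set → Set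
LSet L F X = Inequality F X → CompleteResiduatedLattice.Carrier L

-- Algebras with L-order.  Since there is no function extensionality /
-- quotients, the carrier is a setoid (equality _≈_), operations and
-- ≼ respect _≈_, and antisymmetry concludes _≈_.

module _ (L : CompleteResiduatedLattice) (F : Type) where
  private module L = CompleteResiduatedLattice L
  open L using (_≤_; _⊗_; 1#; ⋀; ⨂)
  open Type F

  record Algebra : Set₁ where
    field
      M : Set
      _≈_ : M → M → Set
      ≈-isEquivalence : IsEquivalence _≈_
      inhabitant : M
      op : (f : Sym) → (Fin (arity f) → M) → M
      op-cong : ∀ f {a b : Fin (arity f) → M} → (∀ k → a k ≈ b k) → op f a ≈ op f b
      _≼_ : M → M → L.Carrier
      ≼-cong : ∀ {a a' b b'} → a ≈ a' → b ≈ b' → (a ≼ b) ≡ (a' ≼ b')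
      ≼-refl : ∀ a → (a ≼ a) ≡ 1#
      ≼-trans : ∀ a b c → (a ≼ b) ⊗ (b ≼ c) ≤ (a ≼ c)
      ≼-compat : ∀ f (a b : Fin (arity f) → M) →
                 ⨂ (arity f) (λ k → a k ≼ b k) ≤ (op f a ≼ op f b)
      ≼-antisym : ∀ a b → (a ≼ b) ≡ 1# → (b ≼ a) ≡ 1# → a ≈ b

  open Algebra

  eval : (A : Algebra) {X : Set} → (X → M A) → Term F X → M A
  eval A v (var x) = v x
  eval A v (app f ts) = op A f (λ k → eval A v (ts k))

  degreeAt : {X : Set} → Inequality F X → (A : Algebra) → (X → M A) → L.Carrier
  degreeAt (t , t') A v = _≼_ A (eval A v t) (eval A v t')

  degree : {X : Set} → Inequality F X → Algebra → L.Carrier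
  degree e A = ⋀ (λ v → degreeAt e A v)

  Mod : {X : Set} → LSet L F X → Algebra → Set
  Mod Σ' A = ∀ e → Σ' e ≤ degree e A

  record SubUniverse (A : Algebra) : Set₁ where
    field
      N : M A → Set
      N-inhabited : Σ (M A) N
      N-closed : ∀ f (a : Fin (arity f) → M A) → (∀ k → N (a k)) → N (op A f a)

  Subalgebra : (A : Algebra) → SubUniverse A → Algebra
  Subalgebra A S = record
    { M = Σ (M A) N
    ; _≈_ = λ x y → _≈_ A (proj₁ x) (proj₁ y)
    ; ≈-isEquivalence = record
        { refl = IsEquivalence.refl (≈-isEquivalence A)
        ; sym = IsEquivalence.sym (≈-isEquivalence A)
        ; trans = IsEquivalence.trans (≈-isEquivalence A) }
    ; inhabitant = N-inhabited
    ; op = λ f a → op A f (λ k → proj₁ (a k)) , N-closed f (λ k → proj₁ (a k)) (λ k → proj₂ (a k))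
    ; op-cong = λ f p → op-cong A f p
    ; _≼_ = λ x y → _≼_ A (proj₁ x) (proj₁ y)
    ; ≼-cong = ≼-cong A
    ; ≼-refl = λ x → ≼-refl A (proj₁ x)
    ; ≼-trans = λ x y z → ≼-trans A (proj₁ x) (proj₁ y) (proj₁ z)
    ; ≼-compat = λ f a b → ≼-compat A f (λ k → proj₁ (a k)) (λ k → proj₁ (b k))
    ; ≼-antisym = λ x y → ≼-antisym A (proj₁ x) (proj₁ y)
    }
    where open SubUniverse S

  record Homomorphism (A B : Algebra) : Set where
    field
      h : M A → M B
      h-cong : ∀ {a b} → _≈_ A a b → _≈_ B (h a) (h b)
      h-op : ∀ f (a : Fin (arity f) → M A) → _≈_ B (h (op A f a)) (op B f (λ k → h (a k)))
      h-≼ : ∀ a b → _≼_ A a b ≤ _≼_ B (h a) (h b)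

  Surjective : {A B : Algebra} → Homomorphism A B → Set
  Surjective {A} {B} φ = ∀ (b : M B) → Σ (M A) (λ a → _≈_ B (Homomorphism.h φ a) b)

  IsHomImage : (B A : Algebra) → Set
  IsHomImage B A = Σ (Homomorphism A B) Surjective

  -- Direct products  (the empty product is the one-element algebra
  -- with ≼ the identity, automatically)

  Product : (I : Set) → (I → Algebra) → Algebra
  Product I A = record
    { M = (i : I) → M (A i)
    ; _≈_ = λ a b → ∀ i → _≈_ (A i) (a i) (b i)
    ; ≈-isEquivalence = record
        { refl = λ i → IsEquivalence.refl (≈-isEquivalence (A i))
        ; sym = λ p i → IsEquivalence.sym (≈-isEquivalence (A i)) (p i)
        ; trans = λ p q i → IsEquivalence.trans (≈-isEquivalence (A i)) (p i) (q i) }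
    ; inhabitant = λ i → inhabitant (A i)
    ; op = λ f a i → op (A i) f (λ k → a k i)
    ; op-cong = λ f p i → op-cong (A i) f (λ k → p k i)
    ; _≼_ = _≼P_
    ; ≼-cong = λ p q → L.⋀-cong (λ i → ≼-cong (A i) (p i) (q i))
    ; ≼-refl = λ a → L.≤-antisym (L.1-top _)
                 (L.⋀-glb _ (λ i → ≤≡ (sym (≼-refl (A i) (a i)))))
    ; ≼-trans = λ a b c → L.⋀-glb _ (λ i →
        L.≤-trans (L.⊗-mono (L.⋀-lb _ i) (L.⋀-lb _ i)) (≼-trans (A i) (a i) (b i) (c i)))
    ; ≼-compat = λ f a b → L.⋀-glb _ (λ i →
        L.≤-trans (L.⨂-mono (arity f) (λ k → L.⋀-lb _ i))
                  (≼-compat (A i) f (λ k → a k i) (λ k → b k i)))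
    ; ≼-antisym = λ a b p q i → ≼-antisym (A i) (a i) (b i) (one p i) (one q i)
    }
    where
    _≼P_ : ((i : I) → M (A i)) → ((i : I) → M (A i)) → L.Carrier
    a ≼P b = ⋀ (λ i → _≼_ (A i) (a i) (b i))
    ≤≡ : ∀ {x y} → x ≡ y → x ≤ y
    ≤≡ refl = L.≤-refl
    one : ∀ {g : I → L.Carrier} → ⋀ g ≡ 1# → ∀ i → g i ≡ 1#
    one {g} p i = L.≤-antisym (L.1-top _) (L.≤-trans (≤≡ (sym p)) (L.⋀-lb g i))

  ClosedUnderSubalgebras : (Algebra → Set) → Set₁
  ClosedUnderSubalgebras K = ∀ (A : Algebra) (S : SubUniverse A) → K A → K (Subalgebra A S)

  ClosedUnderHomImages : (Algebra → Set) → Set₁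
  ClosedUnderHomImages K = ∀ (A B : Algebra) → IsHomImage B A → K A → K B

  ClosedUnderProducts : (Algebra → Set) → Set₁
  ClosedUnderProducts K = ∀ (I : Set) (A : I → Algebra) → (∀ i → K (A i)) → K (Product I A)

-- Satisfaction degrees can only grow along homomorphisms:
-- ‖t ≼ t'‖ at a valuation u is at most ‖t ≼ t'‖ at φ ∘ u, because φ commutes with
-- term evaluation and does not decrease ≼.  A surjective φ reaches every valuation
-- of the image; a subalgebra is read through its inclusion, which preserves ≼
-- exactly; and the order of a product is the meet of the orders of its factors,
-- read through the projections.
module Submission where

open import Defs
open import Data.Product using (_×_; _,_; proj₁; proj₂)
open import Function using (_∘_)
open import Relation.Binary.PropositionalEquality using (_≡_; sym)
open import Relation.Binary.Structures using (IsEquivalence; IsPartialOrder)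

module _ (L : CompleteResiduatedLattice) (F : Type) where
  private module L = CompleteResiduatedLattice L
  open L using (_≤_; ⋀)
  open IsPartialOrder L.≤-isPartialOrder using (reflexive)
  open Algebra
  open Homomorphism

  private
    module ≈ (A : Algebra L F) = IsEquivalence (≈-isEquivalence A)

  eval-cong : (A : Algebra L F) {X : Set} {u w : X → M A} →
              (∀ x → _≈_ A (u x) (w x)) → ∀ t → _≈_ A (eval L F A u t) (eval L F A w t)
  eval-cong A u≈w (var x) = u≈w x
  eval-cong A u≈w (app f ts) = op-cong A f (λ k → eval-cong A u≈w (ts k))

  eval-homomorphism : {A B : Algebra L F} (φ : Homomorphism L F A B) {X : Set} (u : X → M A) →
                      ∀ t → _≈_ B (h φ (eval L F A u t)) (eval L F B (h φ ∘ u) t)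
  eval-homomorphism {B = B} φ u (var x) = ≈.refl B
  eval-homomorphism {B = B} φ u (app f ts) =
    ≈.trans B (h-op φ f _) (op-cong B f (λ k → eval-homomorphism φ u (ts k)))

  degreeAt-cong : {X : Set} (e : Inequality F X) (A : Algebra L F) {u w : X → M A} →
                  (∀ x → _≈_ A (u x) (w x)) → degreeAt L F e A u ≡ degreeAt L F e A w
  degreeAt-cong (t , t') A u≈w = ≼-cong A (eval-cong A u≈w t) (eval-cong A u≈w t')

  ≼-image≡degreeAt : {A B : Algebra L F} (φ : Homomorphism L F A B) {X : Set}
                     (e : Inequality F X) (u : X → M A) →
                     _≼_ B (h φ (eval L F A u (proj₁ e))) (h φ (eval L F A u (proj₂ e)))
                       ≡ degreeAt L F e B (h φ ∘ u)
  ≼-image≡degreeAt {B = B} φ (t , t') u =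
    ≼-cong B (eval-homomorphism φ u t) (eval-homomorphism φ u t')

  degreeAt-homomorphism : {A B : Algebra L F} (φ : Homomorphism L F A B) {X : Set}
                          (e : Inequality F X) (u : X → M A) →
                          degreeAt L F e A u ≤ degreeAt L F e B (h φ ∘ u)
  degreeAt-homomorphism φ e u = L.≤-trans (h-≼ φ _ _) (reflexive (≼-image≡degreeAt φ e u))

  inclusion : (A : Algebra L F) (S : SubUniverse L F A) → Homomorphism L F (Subalgebra L F A S) A
  inclusion A S = record
    { h = proj₁ ; h-cong = λ a≈b → a≈b ; h-op = λ f a → ≈.refl A ; h-≼ = λ a b → L.≤-refl }

  projection : (I : Set) (A : I → Algebra L F) (i : I) → Homomorphism L F (Product L F I A) (A i)
  projection I A i = record
    { h = λ a → a i ; h-cong = λ a≈b → a≈b i ; h-op = λ f a → ≈.refl (A i) ; h-≼ = λ a b → L.⋀-lb _ i }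

  degree-Subalgebra : {X : Set} (e : Inequality F X) (A : Algebra L F) (S : SubUniverse L F A) →
                      degree L F e A ≤ degree L F e (Subalgebra L F A S)
  degree-Subalgebra e A S = L.⋀-glb _ λ v →
    L.≤-trans (L.⋀-lb _ (proj₁ ∘ v)) (reflexive (sym (≼-image≡degreeAt (inclusion A S) e v)))

  degree-homImage : {X : Set} (e : Inequality F X) (A B : Algebra L F) → IsHomImage L F B A →
                    degree L F e A ≤ degree L F e B
  degree-homImage e A B (φ , surjective) = L.⋀-glb _ λ w →
    let u = proj₁ ∘ surjective ∘ w in
    L.≤-trans (L.⋀-lb _ u)
      (L.≤-trans (degreeAt-homomorphism φ e u)
                 (reflexive (degreeAt-cong e B (proj₂ ∘ surjective ∘ w))))

  degree-Product : {X : Set} (e : Inequality F X) (I : Set) (A : I → Algebra L F) →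
                   ⋀ (λ i → degree L F e (A i)) ≤ degree L F e (Product L F I A)
  degree-Product e I A = L.⋀-glb _ λ v → L.⋀-glb _ λ i →
    L.≤-trans (L.⋀-lb _ i)
      (L.≤-trans (L.⋀-lb _ (λ x → v x i))
                 (reflexive (sym (≼-image≡degreeAt (projection I A i) e v))))

mainTheorem4 : (L : CompleteResiduatedLattice) (F : Type) (X : Set) (Σ' : LSet L F X) →
    ClosedUnderSubalgebras L F (Mod L F Σ')
      × ClosedUnderHomImages L F (Mod L F Σ')
      × ClosedUnderProducts L F (Mod L F Σ')
mainTheorem4 L F X Σ' =
    (λ A S A⊨Σ e → ≤-trans (A⊨Σ e) (degree-Subalgebra L F e A S))
  , (λ A B image A⊨Σ e → ≤-trans (A⊨Σ e) (degree-homImage L F e A B image))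
  , (λ I A A⊨Σ e → ≤-trans (⋀-glb _ (λ i → A⊨Σ i e)) (degree-Product L F e I A))
  where open CompleteResiduatedLattice L using (≤-trans; ⋀-glb)
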